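{- Let $\mathcal{G}$ be an Abelian group whose set of involutions is $I^*=\{\iota_1,\iota_2,\ldots,\iota_{2^k-1}\}$ for some integer $k\geq 2$, and let $I=I^*\cup\{0\}$. Let $\iota\in I^*$ and let $n_1,n_2$ be positive integers with $n_1+n_2=2^k$, $n_1\neq 2$ and $n_2\geq 3$. Then there exists a partition $\{A_1,A_2\}$ of $I$ such that $|A_1|=n_1$, $|A_2|=n_2$, $\sum_{a\in A_i}a=0$ for $i=1,2$, and $\iota\notin A_1$.
   Context: The group is written additively with identity $0$. An involution is an element $\iota\neq 0$ with $2\iota=0$. -}

module Defs where

open import Level using (Level)
open import Data.Bool using (Bool; true; false; if_then_else_)
open import Data.Nat using (ℕ; zero; suc)
open import Data.Fin using (Fin; zero; suc)
open import Data.Fin.Subset using (Subset)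
open import Data.Vec using (_∷_; [])
open import Data.Product using (_×_)
open import Relation.Nullary using (¬_)
open import Algebra.Bundles using (AbelianGroup)

module _ {c ℓ : Level} (G : AbelianGroup c ℓ) where
  open AbelianGroup G

  -- x is an involution: x ≠ 0 and 2x = 0 (group written multiplicatively in
  -- the stdlib bundle: _∙_ is the group operation, ε the identity)
  IsInvolution : Carrier → Set ℓ
  IsInvolution x = ¬ (x ≈ ε) × (x ∙ x ≈ ε)

  subsetSum : ∀ {n} → (Fin n → Carrier) → Subset n → Carrier
  subsetSum {zero}  f []      = ε
  subsetSum {suc n} f (b ∷ s) =
    (if b then f zero else ε) ∙ subsetSum (λ i → f (suc i)) s

  -- enumeration of I = {0} ∪ I* from an enumeration e of I*
  -- (index zero ↦ 0, index suc i ↦ e i)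
  elemI : ∀ {N} → (Fin N → Carrier) → Fin (suc N) → Carrier
  elemI e zero    = ε
  elemI e (suc i) = e i

-- Index I by Fin 2ᵏ, with 0 at index zero, so that it becomes a Boolean group, and split it into
-- the 2ᵏ⁻¹ cosets {x, x + ι} of {0, ι}; each of them sums to ι. An even number of cosets other
-- than {0, ι} gives a zero-sum set avoiding ι of size n₁ ≡ 0 (mod 4); adding 0 handles
-- n₁ ≡ 1. For n₁ ≡ 3 add instead {b, d, b + d}, and for n₁ ≡ 2, n₁ ≥ 6, take {0, b, d, b + d + ι}
-- with an odd number of cosets, where b, d and b + d lie in three further cosets: they exist
-- because the quotient by {0, ι} has order 2ᵏ⁻¹ ≥ 4. The bound n₂ ≥ 3 leaves enough cosets,
-- and the complement sums to 0 as well, since I does.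

module Submission where

open import Defs
open import Data.Bool using (true; false; if_then_else_)
open import Data.Nat using (ℕ; zero; suc; _+_; _*_; _∸_; _^_; _≤_; _<_; s≤s)
open import Data.Nat.Properties
  using (+-comm; *-assoc; *-comm; n≤1+n; ≤-trans; *-monoˡ-≤; *-cancelʳ-<; *-cancelʳ-≡;
         +-cancelˡ-≤; m≤n⇒m⊓n≡m; m+n∸m≡n; suc-pred; m^n≢0; m≤m+n; m≤n+m; +-monoˡ-≤)
open import Data.Nat.DivMod using (_divMod_; result)
open import Data.Fin using (Fin; zero; suc; toℕ; _≟_)
open import Data.Fin.Subset using (Subset; _∈_; _∉_; ∁; ∣_∣; ⊥; ⊤; ⁅_⁆; _∪_)
open import Data.Fin.Subset.Properties
  using (∪-identityˡ; x∈p∪q⁻; x∈p∪q⁺; x∈⁅x⁆; x∈⁅y⁆⇒x≡y; ∉⊥; ∣⊥∣≡0; ∣⊤∣≡n; ⊆-antisym; ⊆⊤; ∣∁p∣≡n∸∣p∣)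
open import Data.Vec.Base as Vec using (_∷_; [])
open import Data.List using (List; []; _∷_; _++_; foldr; map; length; take; replicate; allFin)
open import Data.List.Properties using (length-++; length-take)
open import Data.List.Membership.Propositional using () renaming (_∈_ to _∈ₗ_; _∉_ to _∉ₗ_)
open import Data.List.Membership.Propositional.Properties using (∈-++⁺ʳ; ∈-++⁻; ∈-allFin)
open import Data.List.Relation.Unary.Any using (here; there)
open import Data.List.Relation.Unary.All as All using (All; []; _∷_)
open import Data.List.Relation.Unary.All.Properties using (All¬⇒¬Any; ++⁻ʳ)
open import Data.List.Relation.Unary.AllPairs as AllPairs using (AllPairs; []; _∷_)
open import Data.List.Relation.Unary.Unique.Propositional using (Unique)
open import Data.List.Relation.Binary.Sublist.Propositional using (_⊆_; []; _∷_; _∷ʳ_; ⊆-trans; ⊆-refl)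
open import Data.List.Relation.Binary.Sublist.Propositional.Properties
  using (All-resp-⊆; Any-resp-⊆; take-⊆; ++⁺ˡ) renaming (++⁺ to ++⁺-⊆)
open import Data.Product using (_×_; _,_; ∃; ∃₂; proj₁; proj₂)
open import Data.Sum using (inj₁; inj₂)
open import Function using (_∘_)
open import Relation.Nullary using (¬_; yes; no; contradiction)
open import Relation.Binary.PropositionalEquality
  using (_≡_; _≢_; refl; sym; trans; cong; cong₂; subst; subst₂; module ≡-Reasoning)
open import Algebra.Bundles using (AbelianGroup)
open import Algebra.Core using (Op₂)
open import Algebra.Structures using (IsCommutativeMonoid)
open import Algebra.Morphism.Structures using (IsMonoidMonomorphism)
import Algebra.Morphism.MonoidMonomorphism as MonoidMonomorphism
import Algebra.Properties.Group as GroupProperties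
import Algebra.Properties.CommutativeSemigroup as CommutativeSemigroupProperties

module _ {a r} {A : Set a} {R : A → A → Set r} where

  AllPairs-resp-⊆ : ∀ {xs ys} → xs ⊆ ys → AllPairs R ys → AllPairs R xs
  AllPairs-resp-⊆ []         []         = []
  AllPairs-resp-⊆ (y ∷ʳ xs⊆) (_ ∷ Rys)  = AllPairs-resp-⊆ xs⊆ Rys
  AllPairs-resp-⊆ (refl ∷ xs⊆) (Ry ∷ Rys) = All-resp-⊆ xs⊆ Ry ∷ AllPairs-resp-⊆ xs⊆ Rys

  AllPairs-across-++ : ∀ xs {ys} → AllPairs R (xs ++ ys) → All (λ x → All (R x) ys) xs
  AllPairs-across-++ []       _          = []
  AllPairs-across-++ (x ∷ xs) (Rx ∷ Rxs) = ++⁻ʳ xs Rx ∷ AllPairs-across-++ xs Rxs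

module _ {n : ℕ} where

  fromList : List (Fin n) → Subset n
  fromList = foldr (λ x s → ⁅ x ⁆ ∪ s) ⊥

  ∈-fromList⁺ : ∀ {i xs} → i ∈ₗ xs → i ∈ fromList xs
  ∈-fromList⁺ (here refl) = x∈p∪q⁺ (inj₁ (x∈⁅x⁆ _))
  ∈-fromList⁺ (there i∈xs) = x∈p∪q⁺ (inj₂ (∈-fromList⁺ i∈xs))

  ∈-fromList⁻ : ∀ {i} xs → i ∈ fromList xs → i ∈ₗ xs
  ∈-fromList⁻ [] i∈⊥ = contradiction i∈⊥ ∉⊥
  ∈-fromList⁻ (x ∷ xs) i∈ with x∈p∪q⁻ ⁅ x ⁆ (fromList xs) i∈
  ... | inj₁ i∈⁅x⁆ = here (x∈⁅y⁆⇒x≡y x i∈⁅x⁆)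
  ... | inj₂ i∈xs  = there (∈-fromList⁻ xs i∈xs)

  fromList-⊤ : ∀ {xs} → (∀ i → i ∈ₗ xs) → fromList xs ≡ ⊤
  fromList-⊤ covers = ⊆-antisym ⊆⊤ (λ {i} _ → ∈-fromList⁺ (covers i))

∣⁅x⁆∪p∣ : ∀ {n} (x : Fin n) (p : Subset n) → x ∉ p → ∣ ⁅ x ⁆ ∪ p ∣ ≡ suc ∣ p ∣
∣⁅x⁆∪p∣ zero    (true  ∷ p) x∉p = contradiction Vec.here x∉p
∣⁅x⁆∪p∣ zero    (false ∷ p) _   = cong (suc ∘ ∣_∣) (∪-identityˡ p)
∣⁅x⁆∪p∣ (suc x) (true  ∷ p) x∉p = cong suc (∣⁅x⁆∪p∣ x p (x∉p ∘ Vec.there))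
∣⁅x⁆∪p∣ (suc x) (false ∷ p) x∉p = ∣⁅x⁆∪p∣ x p (x∉p ∘ Vec.there)

∣fromList∣ : ∀ {n} {xs : List (Fin n)} → Unique xs → ∣ fromList xs ∣ ≡ length xs
∣fromList∣ {n} [] = ∣⊥∣≡0 n
∣fromList∣ {xs = x ∷ xs} (x∉xs ∷ u) =
  trans (∣⁅x⁆∪p∣ x (fromList xs) (All¬⇒¬Any x∉xs ∘ ∈-fromList⁻ xs)) (cong suc (∣fromList∣ u))

length-covering : ∀ {n} {xs : List (Fin n)} → Unique xs → (∀ i → i ∈ₗ xs) → length xs ≡ n
length-covering {n} u covers =
  trans (sym (∣fromList∣ u)) (trans (cong ∣_∣ (fromList-⊤ covers)) (∣⊤∣≡n n))

module _ {c ℓ} (G : AbelianGroup c ℓ) where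
  open AbelianGroup G renaming (refl to ≈-refl; sym to ≈-sym; trans to ≈-trans)
  open CommutativeSemigroupProperties commutativeSemigroup using (interchange; x∙yz≈y∙xz)
  open GroupProperties group using (inverseˡ-unique)
  open import Relation.Binary.Reasoning.Setoid setoid

  ∙-isInvolution : ∀ {x y} → x ∙ x ≈ ε → y ∙ y ≈ ε → ¬ x ≈ y → IsInvolution G (x ∙ y)
  ∙-isInvolution {x} {y} x²≈ε y²≈ε x≉y = x≉y ∘ x≈y , xy²≈ε
    where
    x≈y : x ∙ y ≈ ε → x ≈ y
    x≈y xy≈ε = ≈-trans (inverseˡ-unique x y xy≈ε) (≈-sym (inverseˡ-unique y y y²≈ε))
    xy²≈ε : (x ∙ y) ∙ (x ∙ y) ≈ ε
    xy²≈ε = ≈-trans (interchange x y x y) (≈-trans (∙-cong x²≈ε y²≈ε) (identityˡ ε))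

  subsetSum-⊥ : ∀ {n} (g : Fin n → Carrier) → subsetSum G g ⊥ ≈ ε
  subsetSum-⊥ {zero}  g = ≈-refl
  subsetSum-⊥ {suc n} g = ≈-trans (identityˡ _) (subsetSum-⊥ (g ∘ suc))

  subsetSum-insert : ∀ {n} (g : Fin n → Carrier) x p → x ∉ p →
                     subsetSum G g (⁅ x ⁆ ∪ p) ≈ g x ∙ subsetSum G g p
  subsetSum-insert g zero (true ∷ p) x∉p = contradiction Vec.here x∉p
  subsetSum-insert g zero (false ∷ p) _ rewrite ∪-identityˡ p =
    ∙-congˡ (≈-sym (identityˡ _))
  subsetSum-insert g (suc x) (b ∷ p) x∉p = begin
    (if b then g zero else ε) ∙ subsetSum G (g ∘ suc) (⁅ x ⁆ ∪ p)
      ≈⟨ ∙-congˡ (subsetSum-insert (g ∘ suc) x p (x∉p ∘ Vec.there)) ⟩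
    (if b then g zero else ε) ∙ (g (suc x) ∙ subsetSum G (g ∘ suc) p)
      ≈⟨ x∙yz≈y∙xz _ _ _ ⟩
    g (suc x) ∙ ((if b then g zero else ε) ∙ subsetSum G (g ∘ suc) p) ∎

  subsetSum-fromList : ∀ {n} (g : Fin n → Carrier) {xs} → Unique xs →
                       subsetSum G g (fromList xs) ≈ foldr _∙_ ε (map g xs)
  subsetSum-fromList g [] = subsetSum-⊥ g
  subsetSum-fromList g {x ∷ xs} (x∉xs ∷ u) =
    ≈-trans (subsetSum-insert g x (fromList xs) (All¬⇒¬Any x∉xs ∘ ∈-fromList⁻ xs))
          (∙-congˡ (subsetSum-fromList g u))

  subsetSum-∁ : ∀ {n} (g : Fin n → Carrier) p →
                subsetSum G g p ∙ subsetSum G g (∁ p) ≈ subsetSum G g ⊤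
  subsetSum-∁ g [] = identityˡ ε
  subsetSum-∁ g (true ∷ p) =
    ≈-trans (interchange _ _ _ _) (∙-cong (identityʳ _) (subsetSum-∁ (g ∘ suc) p))
  subsetSum-∁ g (false ∷ p) =
    ≈-trans (interchange _ _ _ _) (∙-cong (identityˡ _) (subsetSum-∁ (g ∘ suc) p))

module BooleanGroup {M : ℕ} {_⊕_ : Op₂ (Fin M)} {o : Fin M}
  (isCommutativeMonoid : IsCommutativeMonoid _≡_ _⊕_ o)
  (x⊕x≡o : ∀ x → x ⊕ x ≡ o) where

  open IsCommutativeMonoid isCommutativeMonoid using (assoc; comm; identityˡ; identityʳ)
  open ≡-Reasoning
  open import Data.List.Membership.DecPropositional (_≟_ {M}) using (_∈?_)

  sum : List (Fin M) → Fin M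
  sum = foldr _⊕_ o

  sum-++ : ∀ xs ys → sum (xs ++ ys) ≡ sum xs ⊕ sum ys
  sum-++ []       ys = sym (identityˡ (sum ys))
  sum-++ (x ∷ xs) ys = trans (cong (x ⊕_) (sum-++ xs ys)) (sym (assoc x (sum xs) (sum ys)))

  sum-triple : ∀ x y z → sum (x ∷ y ∷ z ∷ []) ≡ (x ⊕ y) ⊕ z
  sum-triple x y z = trans (cong (λ w → x ⊕ (y ⊕ w)) (identityʳ z)) (sym (assoc x y z))

  x⊕[x⊕y]≡y : ∀ x y → x ⊕ (x ⊕ y) ≡ y
  x⊕[x⊕y]≡y x y = begin
    x ⊕ (x ⊕ y) ≡⟨ assoc x x y ⟨
    (x ⊕ x) ⊕ y ≡⟨ cong (_⊕ y) (x⊕x≡o x) ⟩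
    o ⊕ y       ≡⟨ identityˡ y ⟩
    y           ∎

  ⊕-cancelˡ : ∀ z {x y} → z ⊕ x ≡ z ⊕ y → x ≡ y
  ⊕-cancelˡ z {x} {y} eq = begin
    x           ≡⟨ x⊕[x⊕y]≡y z x ⟨
    z ⊕ (z ⊕ x) ≡⟨ cong (z ⊕_) eq ⟩
    z ⊕ (z ⊕ y) ≡⟨ x⊕[x⊕y]≡y z y ⟩
    y           ∎

  module Cosets (ι : Fin M) (ι≢o : ι ≢ o) where

    partner : Fin M → Fin M
    partner x = x ⊕ ι

    partner-involutive : ∀ x → partner (partner x) ≡ x
    partner-involutive x = trans (assoc x ι ι) (trans (cong (x ⊕_) (x⊕x≡o ι)) (identityʳ x))

    partner-injective : ∀ {x y} → partner x ≡ partner y → x ≡ y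
    partner-injective {x} {y} eq =
      trans (sym (partner-involutive x)) (trans (cong partner eq) (partner-involutive y))

    x≢partner-x : ∀ x → x ≢ partner x
    x≢partner-x x eq = ι≢o (sym (⊕-cancelˡ x (trans (identityʳ x) eq)))

    -- x and y lie in different cosets of the subgroup {o, ι}.
    Apart : Fin M → Fin M → Set
    Apart x y = x ≢ y × x ≢ partner y

    Apart-sym : ∀ {x y} → Apart x y → Apart y x
    Apart-sym {x} (x≢y , x≢y′) =
      x≢y ∘ sym , λ y≡x′ → x≢y′ (trans (sym (partner-involutive x)) (cong partner (sym y≡x′)))

    Apart-partnerˡ : ∀ {x y} → Apart x y → Apart (partner x) y
    Apart-partnerˡ {x} (x≢y , x≢y′) =
      (λ x′≡y → x≢y′ (trans (sym (partner-involutive x)) (cong partner x′≡y))) , x≢y ∘ partner-injective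

    Apart-ι : ∀ {x} → Apart o x → Apart ι x
    Apart-ι = subst (λ z → Apart z _) (identityˡ ι) ∘ Apart-partnerˡ

    Apart-⊕ˡ : ∀ z {x y} → Apart x y → Apart (z ⊕ x) (z ⊕ y)
    Apart-⊕ˡ z {y = y} (x≢y , x≢y′) =
      x≢y ∘ ⊕-cancelˡ z , λ eq → x≢y′ (⊕-cancelˡ z (trans eq (assoc z y ι)))

    Transversal : List (Fin M) → Set
    Transversal = AllPairs Apart

    cosets : List (Fin M) → List (Fin M)
    cosets []       = []
    cosets (x ∷ xs) = x ∷ partner x ∷ cosets xs

    cosets-++ : ∀ xs ys → cosets (xs ++ ys) ≡ cosets xs ++ cosets ys
    cosets-++ []       ys = refl
    cosets-++ (x ∷ xs) ys = cong (λ zs → x ∷ partner x ∷ zs) (cosets-++ xs ys)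

    cosets⁺ : ∀ {xs ys} → xs ⊆ ys → cosets xs ⊆ cosets ys
    cosets⁺ []             = []
    cosets⁺ (y ∷ʳ xs⊆ys)   = y ∷ʳ partner y ∷ʳ cosets⁺ xs⊆ys
    cosets⁺ (refl ∷ xs⊆ys) = refl ∷ refl ∷ cosets⁺ xs⊆ys

    length-cosets : ∀ xs → length (cosets xs) ≡ length xs * 2
    length-cosets []       = refl
    length-cosets (x ∷ xs) = cong (2 +_) (length-cosets xs)

    sum-cosets : ∀ xs → sum (cosets xs) ≡ sum (replicate (length xs) ι)
    sum-cosets []       = refl
    sum-cosets (x ∷ xs) = begin
      x ⊕ ((x ⊕ ι) ⊕ sum (cosets xs)) ≡⟨ cong (x ⊕_) (assoc x ι _) ⟩
      x ⊕ (x ⊕ (ι ⊕ sum (cosets xs))) ≡⟨ x⊕[x⊕y]≡y x _ ⟩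
      ι ⊕ sum (cosets xs)             ≡⟨ cong (ι ⊕_) (sum-cosets xs) ⟩
      ι ⊕ sum (replicate (length xs) ι) ∎

    sum-replicate-even : ∀ j → sum (replicate (j * 2) ι) ≡ o
    sum-replicate-even zero    = refl
    sum-replicate-even (suc j) = trans (x⊕[x⊕y]≡y ι _) (sum-replicate-even j)

    All-≢-cosets : ∀ {x ys} → All (Apart x) ys → All (x ≢_) (cosets ys)
    All-≢-cosets []                        = []
    All-≢-cosets ((x≢y , x≢y′) ∷ x-apart) = x≢y ∷ x≢y′ ∷ All-≢-cosets x-apart

    ∉-cosets : ∀ {x ys} → All (Apart x) ys → x ∉ₗ cosets ys
    ∉-cosets = All¬⇒¬Any ∘ All-≢-cosets

    ∉-cosets⇒Apart : ∀ {x} ys → x ∉ₗ cosets ys → All (Apart x) ys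
    ∉-cosets⇒Apart []       _   = []
    ∉-cosets⇒Apart (y ∷ ys) x∉ =
      (x∉ ∘ here , x∉ ∘ there ∘ here) ∷ ∉-cosets⇒Apart ys (x∉ ∘ there ∘ there)

    Unique-cosets : ∀ {xs} → Transversal xs → Unique (cosets xs)
    Unique-cosets []                          = []
    Unique-cosets {x ∷ _} (x-apart ∷ apart) =
      (x≢partner-x x ∷ All-≢-cosets x-apart) ∷
      All-≢-cosets (All.map Apart-partnerˡ x-apart) ∷
      Unique-cosets apart

    extend : ∀ {Q} → Transversal Q → (xs : List (Fin M)) →
             ∃ λ W → Transversal (W ++ Q) × All (_∈ₗ cosets (W ++ Q)) xs
    extend tr [] = [] , tr , []
    extend {Q} tr (x ∷ xs) with extend tr xs
    ... | W , tr′ , covered with x ∈? cosets (W ++ Q)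
    ...   | yes x∈ = W , tr′ , x∈ ∷ covered
    ...   | no  x∉ = x ∷ W , ∉-cosets⇒Apart (W ++ Q) x∉ ∷ tr′ , here refl ∷ All.map (there ∘ there) covered

    completion : ∀ {Q} → Transversal Q →
                 ∃ λ W → Transversal (W ++ Q) × (∀ x → x ∈ₗ cosets (W ++ Q))
    completion tr with extend tr (allFin M)
    ... | W , tr′ , covered = W , tr′ , λ x → All.lookup covered (∈-allFin x)

    record ZeroSumList (n : ℕ) : Set where
      field
        elements : List (Fin M)
        unique   : Unique elements
        length≡n : length elements ≡ n
        ι∉       : ι ∉ₗ elements
        sum≡o    : sum elements ≡ o

    span-transversal : ∀ {b d} → Apart b d → Apart b o → Apart d o →
                       Transversal (o ∷ b ∷ d ∷ b ⊕ d ∷ [])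
    span-transversal {b} {d} b#d b#o d#o =
      (Apart-sym b#o ∷ Apart-sym d#o ∷ o#b⊕d ∷ []) ∷ (b#d ∷ b#b⊕d ∷ []) ∷ (d#b⊕d ∷ []) ∷ [] ∷ []
      where
      o#b⊕d : Apart o (b ⊕ d)
      o#b⊕d = subst (λ z → Apart z (b ⊕ d)) (x⊕x≡o b) (Apart-⊕ˡ b b#d)
      b#b⊕d : Apart b (b ⊕ d)
      b#b⊕d = subst (λ z → Apart z (b ⊕ d)) (identityʳ b) (Apart-⊕ˡ b (Apart-sym d#o))
      d#b⊕d : Apart d (b ⊕ d)
      d#b⊕d = subst₂ Apart (identityʳ d) (comm d b) (Apart-⊕ˡ d (Apart-sym b#o))

    ι∉-cosets-++ : ∀ {W Q} P {C} → Transversal (W ++ o ∷ Q) → P ⊆ W → C ⊆ o ∷ cosets Q →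
                   ι ∉ₗ cosets P ++ C
    ι∉-cosets-++ {W} {Q} P tr P⊆W C⊆ ι∈ with ∈-++⁻ (cosets P) ι∈
    ... | inj₁ ι∈P = ∉-cosets (All.map Apart-ι P-apart-o) ι∈P
      where
      P-apart-o : All (Apart o) P
      P-apart-o = All.map (Apart-sym ∘ All.head) (All-resp-⊆ P⊆W (AllPairs-across-++ W tr))
    ... | inj₂ ι∈C with Any-resp-⊆ C⊆ ι∈C
    ...   | here  ι≡o = ι≢o ι≡o
    ...   | there ι∈Q = ∉-cosets (All.map Apart-ι o-apart) ι∈Q
      where
      o-apart : All (Apart o) Q
      o-apart = AllPairs.head (AllPairs-resp-⊆ (++⁺ˡ W ⊆-refl) tr)

    module _ (t : ℕ) (M≡t*4 : M ≡ t * 4) where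

      length-transversal : ∀ {T} → Transversal T → (∀ x → x ∈ₗ cosets T) → length T ≡ t * 2
      length-transversal {T} tr covers = *-cancelʳ-≡ (length T) (t * 2) 2 (begin
        length T * 2      ≡⟨ length-cosets T ⟨
        length (cosets T) ≡⟨ length-covering (Unique-cosets tr) covers ⟩
        M                 ≡⟨ M≡t*4 ⟩
        t * 4             ≡⟨ *-assoc t 2 2 ⟨
        t * 2 * 2         ∎)

      zero-sum-enumeration : ∃ λ F → Unique F × (∀ x → x ∈ₗ F) × sum F ≡ o
      zero-sum-enumeration with completion {Q = []} []
      ... | W , tr , covers = cosets (W ++ []) , Unique-cosets tr , covers , (begin
        sum (cosets (W ++ []))                ≡⟨ sum-cosets (W ++ []) ⟩
        sum (replicate (length (W ++ [])) ι)  ≡⟨ cong (λ m → sum (replicate m ι)) (length-transversal tr covers) ⟩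
        sum (replicate (t * 2) ι)             ≡⟨ sum-replicate-even t ⟩
        o                                     ∎)

      assemble : ∀ {Q C} m → Transversal (o ∷ Q) → C ⊆ o ∷ cosets Q →
                 sum C ≡ sum (replicate m ι) → suc (length Q) + m ≤ t * 2 →
                 ZeroSumList (length C + m * 2)
      assemble {Q} {C} m tr C⊆ sumC bound with completion tr
      ... | W , tr′ , covers = record
        { elements = cosets P ++ C
        ; unique   = AllPairs-resp-⊆ (++⁺-⊆ (cosets⁺ P⊆W) C⊆cosets)
                       (subst Unique (cosets-++ W (o ∷ Q)) (Unique-cosets tr′))
        ; length≡n = trans (length-++ (cosets P))
                       (trans (cong (_+ length C) (trans (length-cosets P) (cong (_* 2) |P|≡m)))
                              (+-comm (m * 2) (length C)))
        ; ι∉       = ι∉-cosets-++ P tr′ P⊆W C⊆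
        ; sum≡o    = begin
            sum (cosets P ++ C)                  ≡⟨ sum-++ (cosets P) C ⟩
            sum (cosets P) ⊕ sum C               ≡⟨ cong₂ _⊕_ (trans (sum-cosets P) (cong (λ k → sum (replicate k ι)) |P|≡m)) sumC ⟩
            sum (replicate m ι) ⊕ sum (replicate m ι) ≡⟨ x⊕x≡o _ ⟩
            o                                    ∎
        }
        where
        P = take m W
        P⊆W : P ⊆ W
        P⊆W = take-⊆ m W
        C⊆cosets : C ⊆ cosets (o ∷ Q)
        C⊆cosets = ⊆-trans C⊆ (refl ∷ partner o ∷ʳ ⊆-refl)
        m≤|W| : m ≤ length W
        m≤|W| = +-cancelˡ-≤ (suc (length Q)) m (length W) (subst (suc (length Q) + m ≤_)
          (trans (sym (length-transversal tr′ covers)) (trans (length-++ W) (+-comm (length W) _))) bound)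
        |P|≡m : length P ≡ m
        |P|≡m = trans (length-take m W) (m≤n⇒m⊓n≡m m≤|W|)

      -- The cosets of {o, ι} form a group of order 2t ≥ 4, which contains a Klein four-group.
      klein-transversal : 2 ≤ t → ∃₂ λ b d → Transversal (o ∷ b ∷ d ∷ b ⊕ d ∷ [])
      klein-transversal 2≤t with completion {Q = o ∷ []} ([] ∷ [])
      ... | W , tr , covers =
        pick W tr (subst (4 ≤_) (sym (length-transversal tr covers)) (*-monoˡ-≤ 2 2≤t))
        where
        pick : ∀ W → Transversal (W ++ o ∷ []) → 4 ≤ length (W ++ o ∷ []) →
               ∃₂ λ b d → Transversal (o ∷ b ∷ d ∷ b ⊕ d ∷ [])
        pick (b ∷ d ∷ W) (b# ∷ d# ∷ _) _ =
          b , d , span-transversal (All.head b#) (All.lookup b# (∈-++⁺ʳ (d ∷ W) (here refl)))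
                                   (All.lookup d# (∈-++⁺ʳ W (here refl)))
        pick []       _ (s≤s ())
        pick (_ ∷ []) _ (s≤s (s≤s ()))

      zeroSum-4j : ∀ j → suc j ≤ t → ZeroSumList (j * 4)
      zeroSum-4j j bound = subst ZeroSumList (*-assoc j 2 2)
        (assemble {Q = []} {C = []} (j * 2) ([] ∷ []) (o ∷ʳ [])
          (sym (sum-replicate-even j)) (≤-trans (n≤1+n _) (*-monoˡ-≤ 2 bound)))

      zeroSum-4j+1 : ∀ j → suc j ≤ t → ZeroSumList (1 + j * 4)
      zeroSum-4j+1 j bound = subst ZeroSumList (cong suc (*-assoc j 2 2))
        (assemble {Q = []} {C = o ∷ []} (j * 2) ([] ∷ []) (refl ∷ [])
          (trans (x⊕x≡o o) (sym (sum-replicate-even j))) (≤-trans (n≤1+n _) (*-monoˡ-≤ 2 bound)))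

      zeroSum-4j+3 : ∀ j → 2 + j ≤ t → ZeroSumList (3 + j * 4)
      zeroSum-4j+3 j bound with klein-transversal (≤-trans (m≤m+n 2 j) bound)
      ... | b , d , tr = subst ZeroSumList (cong (3 +_) (*-assoc j 2 2))
        (assemble {C = b ∷ d ∷ b ⊕ d ∷ []} (j * 2) tr
          (o ∷ʳ refl ∷ _ ∷ʳ refl ∷ _ ∷ʳ refl ∷ _ ∷ʳ [])
          (trans (trans (sum-triple b d (b ⊕ d)) (x⊕x≡o (b ⊕ d))) (sym (sum-replicate-even j)))
          (*-monoˡ-≤ 2 bound))

      zeroSum-4j+6 : ∀ j → 3 + j ≤ t → ZeroSumList (6 + j * 4)
      zeroSum-4j+6 j bound with klein-transversal (≤-trans (m≤m+n 2 (suc j)) bound)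
      ... | b , d , tr = subst ZeroSumList (cong (6 +_) (*-assoc j 2 2))
        (assemble {C = o ∷ b ∷ d ∷ partner (b ⊕ d) ∷ []} (suc (j * 2)) tr
          (refl ∷ refl ∷ _ ∷ʳ refl ∷ _ ∷ʳ _ ∷ʳ refl ∷ [])
          sum≡ι (≤-trans (n≤1+n _) (*-monoˡ-≤ 2 bound)))
        where
        sum≡ι : sum (o ∷ b ∷ d ∷ partner (b ⊕ d) ∷ []) ≡ sum (replicate (suc (j * 2)) ι)
        sum≡ι = begin
          o ⊕ sum (b ∷ d ∷ partner (b ⊕ d) ∷ []) ≡⟨ identityˡ _ ⟩
          sum (b ∷ d ∷ partner (b ⊕ d) ∷ [])     ≡⟨ sum-triple b d _ ⟩
          (b ⊕ d) ⊕ ((b ⊕ d) ⊕ ι)               ≡⟨ x⊕[x⊕y]≡y (b ⊕ d) ι ⟩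
          ι                                     ≡⟨ identityʳ ι ⟨
          ι ⊕ o                                 ≡⟨ cong (ι ⊕_) (sum-replicate-even j) ⟨
          ι ⊕ sum (replicate (j * 2) ι)         ∎

      zeroSumList : ∀ n → 3 + n ≤ t * 4 → n ≢ 2 → ZeroSumList n
      zeroSumList n bound n≢2 with n divMod 4
      ... | result j r n≡r+j*4 = subst ZeroSumList (sym n≡r+j*4)
        (by-residue r j (subst (λ m → 3 + m ≤ t * 4) n≡r+j*4 bound) (n≢2 ∘ trans n≡r+j*4))
        where
        quotient< : ∀ e a → e + a * 4 < t * 4 → a < t
        quotient< e a lt = *-cancelʳ-< 4 a t (≤-trans (s≤s (m≤n+m (a * 4) e)) lt)

        by-residue : ∀ (r : Fin 4) j → 3 + (toℕ r + j * 4) ≤ t * 4 → toℕ r + j * 4 ≢ 2 →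
                     ZeroSumList (toℕ r + j * 4)
        by-residue zero                   j       b _   = zeroSum-4j j (quotient< 2 j b)
        by-residue (suc zero)             j       b _   = zeroSum-4j+1 j (quotient< 3 j b)
        by-residue (suc (suc zero))       zero    _ ≢2  = contradiction refl ≢2
        by-residue (suc (suc zero))       (suc j) b _   = zeroSum-4j+6 j (quotient< 0 (2 + j) b)
        by-residue (suc (suc (suc zero))) j       b _   = zeroSum-4j+3 j (quotient< 1 (suc j) b)

module Involutions {c ℓ} (G : AbelianGroup c ℓ) {N : ℕ}
  (e : Fin N → AbelianGroup.Carrier G)
  (e-injective : ∀ i j → AbelianGroup._≈_ G (e i) (e j) → i ≡ j)
  (e-involution : ∀ i → IsInvolution G (e i))
  (e-complete : ∀ x → IsInvolution G x → ∃ λ i → AbelianGroup._≈_ G x (e i)) where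

  open AbelianGroup G renaming (refl to ≈-refl; sym to ≈-sym; trans to ≈-trans)

  elem : Fin (suc N) → Carrier
  elem = elemI G e

  elem-injective : ∀ {i j} → elem i ≈ elem j → i ≡ j
  elem-injective {zero}  {zero}  _   = refl
  elem-injective {zero}  {suc j} ε≈  = contradiction (≈-sym ε≈) (proj₁ (e-involution j))
  elem-injective {suc i} {zero}  ≈ε  = contradiction ≈ε (proj₁ (e-involution i))
  elem-injective {suc i} {suc j} eq  = cong suc (e-injective i j eq)

  elem-square : ∀ i → elem i ∙ elem i ≈ ε
  elem-square zero    = identityˡ ε
  elem-square (suc i) = proj₂ (e-involution i)

  elem-∙-isInvolution : ∀ {i j} → i ≢ j → IsInvolution G (elem i ∙ elem j)
  elem-∙-isInvolution {i} {j} i≢j =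
    ∙-isInvolution G (elem-square i) (elem-square j) (i≢j ∘ elem-injective)

  _⊕_ : Op₂ (Fin (suc N))
  i ⊕ j with i ≟ j
  ... | yes _   = zero
  ... | no  i≢j = suc (proj₁ (e-complete _ (elem-∙-isInvolution i≢j)))

  elem-homo : ∀ i j → elem (i ⊕ j) ≈ elem i ∙ elem j
  elem-homo i j with i ≟ j
  ... | yes refl = ≈-sym (elem-square i)
  ... | no  i≢j  = ≈-sym (proj₂ (e-complete _ (elem-∙-isInvolution i≢j)))

  elem-isMonoidMonomorphism :
    IsMonoidMonomorphism (record { Carrier = Fin (suc N) ; _≈_ = _≡_ ; _∙_ = _⊕_ ; ε = zero })
                         rawMonoid elem
  elem-isMonoidMonomorphism = record
    { isMonoidHomomorphism = record
      { isMagmaHomomorphism = record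
        { isRelHomomorphism = record { cong = λ { refl → ≈-refl } }
        ; homo              = elem-homo
        }
      ; ε-homo = ≈-refl
      }
    ; injective = elem-injective
    }

  ⊕-isCommutativeMonoid : IsCommutativeMonoid _≡_ _⊕_ zero
  ⊕-isCommutativeMonoid =
    MonoidMonomorphism.isCommutativeMonoid elem-isMonoidMonomorphism isCommutativeMonoid

  x⊕x≡zero : ∀ i → i ⊕ i ≡ zero
  x⊕x≡zero i = elem-injective (≈-trans (elem-homo i i) (elem-square i))

  open BooleanGroup ⊕-isCommutativeMonoid x⊕x≡zero

  subsetSum-fromList-elem : ∀ {xs} → Unique xs → subsetSum G elem (fromList xs) ≈ elem (sum xs)
  subsetSum-fromList-elem {xs} u = ≈-trans (subsetSum-fromList G elem u) (≈-sym (elem-sum xs))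
    where
    elem-sum : ∀ xs → elem (sum xs) ≈ foldr _∙_ ε (map elem xs)
    elem-sum []       = ≈-refl
    elem-sum (x ∷ xs) = ≈-trans (elem-homo x (sum xs)) (∙-congˡ (elem-sum xs))

  zeroSum-partition : (ι : Carrier) → IsInvolution G ι → (t : ℕ) → suc N ≡ t * 4 →
    (n₁ n₂ : ℕ) → n₁ + n₂ ≡ suc N → n₁ ≢ 2 → 3 ≤ n₂ →
    ∃ λ (A : Subset (suc N)) →
      ∣ A ∣ ≡ n₁ × ∣ ∁ A ∣ ≡ n₂ ×
      subsetSum G elem A ≈ ε × subsetSum G elem (∁ A) ≈ ε ×
      (∀ i → i ∈ A → ¬ (elem i ≈ ι))
  zeroSum-partition ι ι-involution t N+1≡t*4 n₁ n₂ n₁+n₂≡N+1 n₁≢2 3≤n₂ =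
    fromList elements , ∣A∣≡n₁ , ∣∁A∣≡n₂ , ΣA≈ε , Σ∁A≈ε , ι∉A
    where
    ιᵢ : Fin (suc N)
    ιᵢ = suc (proj₁ (e-complete ι ι-involution))
    ιᵢ≢zero : ιᵢ ≢ zero
    ιᵢ≢zero ()
    open Cosets ιᵢ ιᵢ≢zero
    bound : 3 + n₁ ≤ t * 4
    bound = subst (3 + n₁ ≤_) (trans (+-comm n₂ n₁) (trans n₁+n₂≡N+1 N+1≡t*4)) (+-monoˡ-≤ n₁ 3≤n₂)
    open ZeroSumList (zeroSumList t N+1≡t*4 n₁ bound n₁≢2)
    ∣A∣≡n₁ : ∣ fromList elements ∣ ≡ n₁
    ∣A∣≡n₁ = trans (∣fromList∣ unique) length≡n
    ∣∁A∣≡n₂ : ∣ ∁ (fromList elements) ∣ ≡ n₂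
    ∣∁A∣≡n₂ = trans (∣∁p∣≡n∸∣p∣ (fromList elements))
      (trans (cong (suc N ∸_) ∣A∣≡n₁) (trans (cong (_∸ n₁) (sym n₁+n₂≡N+1)) (m+n∸m≡n n₁ n₂)))
    ΣA≈ε : subsetSum G elem (fromList elements) ≈ ε
    ΣA≈ε = ≈-trans (subsetSum-fromList-elem unique) (reflexive (cong elem sum≡o))
    Σ∁A≈ε : subsetSum G elem (∁ (fromList elements)) ≈ ε
    Σ∁A≈ε with zero-sum-enumeration t N+1≡t*4
    ... | F , F-unique , F-covers , sumF≡o = begin
      subsetSum G elem (∁ A)                       ≈⟨ identityˡ _ ⟨
      ε ∙ subsetSum G elem (∁ A)                   ≈⟨ ∙-congʳ ΣA≈ε ⟨
      subsetSum G elem A ∙ subsetSum G elem (∁ A)  ≈⟨ subsetSum-∁ G elem A ⟩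
      subsetSum G elem ⊤                           ≡⟨ cong (subsetSum G elem) (fromList-⊤ F-covers) ⟨
      subsetSum G elem (fromList F)                ≈⟨ subsetSum-fromList-elem F-unique ⟩
      elem (sum F)                                 ≡⟨ cong elem sumF≡o ⟩
      ε                                            ∎
      where
      A = fromList elements
      open import Relation.Binary.Reasoning.Setoid setoid
    ι∉A : ∀ i → i ∈ fromList elements → ¬ (elem i ≈ ι)
    ι∉A i i∈A elem-i≈ι = ι∉ (subst (_∈ₗ elements)
      (elem-injective (≈-trans elem-i≈ι (proj₂ (e-complete ι ι-involution)))) (∈-fromList⁻ elements i∈A))

lemma4 : ∀ {c ℓ} (G : AbelianGroup c ℓ) → let open AbelianGroup G in
    (k : ℕ) → 2 ≤ k →
    (e : Fin (2 ^ k ∸ 1) → Carrier) →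
    (∀ i j → e i ≈ e j → i ≡ j) →
    (∀ i → IsInvolution G (e i)) →
    (∀ x → IsInvolution G x → ∃ λ i → x ≈ e i) →
    (ι : Carrier) → IsInvolution G ι →
    (n₁ n₂ : ℕ) → 1 ≤ n₁ → 1 ≤ n₂ → n₁ + n₂ ≡ 2 ^ k → n₁ ≢ 2 → 3 ≤ n₂ →
    ∃ λ (A : Subset (suc (2 ^ k ∸ 1))) →
      ∣ A ∣ ≡ n₁ × ∣ ∁ A ∣ ≡ n₂ ×
      subsetSum G (elemI G e) A ≈ ε × subsetSum G (elemI G e) (∁ A) ≈ ε ×
      (∀ i → i ∈ A → ¬ (elemI G e i ≈ ι))
lemma4 G (suc zero) (s≤s ()) _ _ _ _ _ _ _ _ _ _ _ _ _
lemma4 G (suc (suc k)) _ e e-injective e-involution e-complete ι ι-involution n₁ n₂ _ _ n₁+n₂≡2^k n₁≢2 3≤n₂ =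
  Involutions.zeroSum-partition G e e-injective e-involution e-complete ι ι-involution (2 ^ k) N+1≡2^k*4
    n₁ n₂ (trans n₁+n₂≡2^k (sym N+1≡2^k+2)) n₁≢2 3≤n₂
  where
  N+1≡2^k+2 : suc (2 ^ suc (suc k) ∸ 1) ≡ 2 ^ suc (suc k)
  N+1≡2^k+2 = suc-pred (2 ^ suc (suc k)) {{m^n≢0 2 (suc (suc k))}}
  N+1≡2^k*4 : suc (2 ^ suc (suc k) ∸ 1) ≡ 2 ^ k * 4
  N+1≡2^k*4 = trans N+1≡2^k+2 (trans (sym (*-assoc 2 2 (2 ^ k))) (*-comm 4 (2 ^ k)))
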